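{- Let $X,X'$ be good terms, $xs,xs'$ varsorts and $x,x'$ variables. The following are equivalent: (1) $\mathsf{Abs}\,xs\,x\,X=\mathsf{Abs}\,xs'\,x'\,X'$; (2) $xs=xs'\wedge\big(\exists y\notin\{x,x'\}.\ \mathsf{fresh}\,xs\,y\,X\wedge\mathsf{fresh}\,xs\,y\,X'\wedge X[y\wedge x]_{xs}=X'[y\wedge x']_{xs}\big)$; (3) $xs=xs'\wedge\big(\forall y\notin\{x,x'\}.\ \mathsf{fresh}\,xs\,y\,X\wedge\mathsf{fresh}\,xs\,y\,X'\Longrightarrow X[y\wedge x]_{xs}=X'[y\wedge x']_{xs}\big)$.
   Context: Fix arbitrary types $\mathbf{var}$, $\mathbf{varsort}$, $\mathbf{opsym}$, $\mathbf{index}$, $\mathbf{bindex}$; standing assumption: $|\mathbf{var}|$ is a regular infinite cardinal. An $(\alpha,\beta)$-input is a partial function $f:\alpha\to\beta\ \mathsf{option}$, with $\mathsf{dom}\,f=\{i\mid f\,i\neq\mathsf{None}\}$; $\uparrow P\,f$ lifts a predicate to inputs (holds iff $P\,b$ for all $f\,i=\mathsf{Some}\,b$), binary $\uparrow P\,f\,f'$ holds iff for each $i$ both are $\mathsf{None}$ or both are defined with $P$-related values. Quasiterms and quasiabstractions are the free mutually inductive datatypes with constructors $\mathsf{qVar}\,xs\,x$, $\mathsf{qOp}\,\delta\,inp\,binp$ ($inp$ an $(\mathbf{index},\mathbf{qterm})$-input, $binp$ a $(\mathbf{bindex},\mathbf{qabs})$-input) and $\mathsf{qAbs}\,xs\,x\,X$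 (binding variable $x$ of varsort $xs$ in $X$). Freshness $\mathsf{qFresh}\,ys\,y$ (variable $y$ of varsort $ys$ does not occur free), swapping $X[z_1\wedge z_2]_{zs}$ (exchanging the variables $z_1,z_2$ of varsort $zs$ everywhere, including binding positions) and alpha-equivalence are defined as usual, with $\mathsf{alphaAbs}\,(\mathsf{qAbs}\,xs\,x\,X)\,(\mathsf{qAbs}\,xs'\,x'\,X')\iff xs=xs'\wedge\exists y\notin\{x,x'\}.\ \mathsf{qFresh}\,xs\,y\,X\wedge\mathsf{qFresh}\,xs\,y\,X'\wedge\mathsf{alpha}\,(X[y\wedge x]_{xs})\,(X'[y\wedge x']_{xs})$, $\mathsf{alpha}$ on $\mathsf{qVar}$ being equality, and on $\mathsf{qOp}$ requiring equal symbols and componentwise-related inputs with equal domains. A quasiterm is good if every $\mathsf{qOp}$ occurring in it has free and bound inputs with domains of cardinality $<|\mathbf{var}|$. The types $\mathbf{term}$ and $\mathbf{abs}$ of terms and abstractions are the quotients of quasiterms and quasiabstractions by $\mathsf{alpha}$ and $\mathsf{alphaAbs}$ (which are equivalences on good items); $\mathsf{good}$/$\mathsf{goodAbs}$ hold for classes of good quasiterms/quasiabstractions. On terms we have the constructors $\mathsf{Var}:\mathbf{varsort}\to\mathbf{var}\to\mathbf{term}$, $\mathsf{Op}:\mathbf{opsym}\to(\mathbf{index},\mathbf{term})\,\mathbf{input}\to(\mathbf{bindex},\mathbf{abs})\,\mathbf{input}\to\mathbf{term}$, $\mathsf{Abs}:\mathbf{varsort}\to\mathbf{var}\to\mathbf{term}\to\mathbf{abs}$,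 and the operators lifted from quasiterms: freshness $\mathsf{fresh}\,xs\,x\,X$ / $\mathsf{freshAbs}\,xs\,x\,A$ (variable $x$ of varsort $xs$ does not occur free) and swapping $X[z_1\wedge z_2]_{zs}$. -}

module Defs where

open import Level using (0ℓ)
open import Data.Nat using (ℕ)
open import Data.Fin using (Fin)
open import Data.Maybe using (Maybe; just; nothing; Is-just; map)
open import Data.Maybe.Relation.Unary.All using (All)
open import Data.Maybe.Relation.Binary.Pointwise using (Pointwise)
open import Data.Product using (Σ; ∃-syntax; _×_; _,_)
open import Data.Sum using (_⊎_)
open import Relation.Nullary using (¬_; yes; no)
open import Relation.Binary.Definitions using (DecidableEquality)
open import Relation.Binary.PropositionalEquality using (_≡_; _≢_)
open import Function.Bundles using (_↣_; _↔_)

_<ᶜ_ : Set → Set → Set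
A <ᶜ B = ¬ (B ↣ A)

Finite : Set → Set
Finite A = ∃[ n ] (A ↔ Fin n)

Infinite : Set → Set
Infinite A = ¬ Finite A

Regular : Set → Set₁
Regular V = (I : Set) (A : I → Set) → I <ᶜ V → (∀ i → A i <ᶜ V) → Σ I A <ᶜ V

dom : {α β : Set} → (α → Maybe β) → Set
dom {α} f = Σ α (λ i → Is-just (f i))

Lift : {α β : Set} → (β → Set) → (α → Maybe β) → Set
Lift P f = ∀ i → All P (f i)

Lift₂ : {α β β' : Set} → (β → β' → Set) → (α → Maybe β) → (α → Maybe β') → Set
Lift₂ P f f' = ∀ i → Pointwise P (f i) (f' i)

module Syntax (var varsort opsym index bindex : Set)
              (_≟v_ : DecidableEquality var)
              (_≟s_ : DecidableEquality varsort) where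

  data QTerm : Set
  data QAbs : Set

  data QTerm where
    qVar : varsort → var → QTerm
    qOp  : opsym → (index → Maybe QTerm) → (bindex → Maybe QAbs) → QTerm

  data QAbs where
    qAbs : varsort → var → QTerm → QAbs

  data qFresh (ys : varsort) (y : var) : QTerm → Set
  data qFreshAbs (ys : varsort) (y : var) : QAbs → Set

  data qFresh ys y where
    qVar : ∀ {xs x} → ¬ (ys ≡ xs × y ≡ x) → qFresh ys y (qVar xs x)
    qOp  : ∀ {δ inp binp} → Lift (qFresh ys y) inp → Lift (qFreshAbs ys y) binp →
           qFresh ys y (qOp δ inp binp)

  data qFreshAbs ys y where
    qAbs : ∀ {xs x X} → (ys ≡ xs × y ≡ x) ⊎ qFresh ys y X → qFreshAbs ys y (qAbs xs x X)

  swapVar : varsort → var → var → varsort → var → var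
  swapVar zs z1 z2 xs x with xs ≟s zs
  ... | no _ = x
  ... | yes _ with x ≟v z1
  ...   | yes _ = z2
  ...   | no _ with x ≟v z2
  ...     | yes _ = z1
  ...     | no _ = x

  _[_∧_]_ : QTerm → var → var → varsort → QTerm
  _[_∧_]ₐ_ : QAbs → var → var → varsort → QAbs
  swapM : Maybe QTerm → var → var → varsort → Maybe QTerm
  swapMₐ : Maybe QAbs → var → var → varsort → Maybe QAbs

  qVar xs x [ z1 ∧ z2 ] zs = qVar xs (swapVar zs z1 z2 xs x)
  qOp δ inp binp [ z1 ∧ z2 ] zs =
    qOp δ (λ i → swapM (inp i) z1 z2 zs) (λ i → swapMₐ (binp i) z1 z2 zs)
  qAbs xs x X [ z1 ∧ z2 ]ₐ zs = qAbs xs (swapVar zs z1 z2 xs x) (X [ z1 ∧ z2 ] zs)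
  swapM nothing z1 z2 zs = nothing
  swapM (just X) z1 z2 zs = just (X [ z1 ∧ z2 ] zs)
  swapMₐ nothing z1 z2 zs = nothing
  swapMₐ (just A) z1 z2 zs = just (A [ z1 ∧ z2 ]ₐ zs)

  data alpha : QTerm → QTerm → Set
  data alphaAbs : QAbs → QAbs → Set

  data alpha where
    qVar : ∀ {xs x} → alpha (qVar xs x) (qVar xs x)
    qOp  : ∀ {δ inp inp' binp binp'} →
           Lift₂ alpha inp inp' → Lift₂ alphaAbs binp binp' →
           alpha (qOp δ inp binp) (qOp δ inp' binp')

  data alphaAbs where
    qAbs : ∀ {xs x x' X X'} (y : var) → y ≢ x → y ≢ x' →
           qFresh xs y X → qFresh xs y X' →
           alpha (X [ y ∧ x ] xs) (X' [ y ∧ x' ] xs) →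
           alphaAbs (qAbs xs x X) (qAbs xs x' X')

  data qGood : QTerm → Set
  data qGoodAbs : QAbs → Set

  data qGood where
    qVar : ∀ {xs x} → qGood (qVar xs x)
    qOp  : ∀ {δ inp binp} → Lift qGood inp → Lift qGoodAbs binp →
           dom inp <ᶜ var → dom binp <ᶜ var → qGood (qOp δ inp binp)

  data qGoodAbs where
    qAbs : ∀ {xs x X} → qGood X → qGoodAbs (qAbs xs x X)

  -- Terms and abstractions: alpha-classes of quasiterms, represented by
  -- their representatives; equality of terms is alpha-equivalence.

  term : Set
  term = QTerm

  abs : Set
  abs = QAbs

  _≈_ : term → term → Set
  _≈_ = alpha

  _≈ₐ_ : abs → abs → Set
  _≈ₐ_ = alphaAbs

  Var : varsort → var → term
  Var = qVar

  Op : opsym → (index → Maybe term) → (bindex → Maybe abs) → term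
  Op = qOp

  Abs : varsort → var → term → abs
  Abs = qAbs

  good : term → Set
  good = qGood

  goodAbs : abs → Set
  goodAbs = qGoodAbs

  fresh : varsort → var → term → Set
  fresh = qFresh

  freshAbs : varsort → var → abs → Set
  freshAbs = qFreshAbs

-- (1) ⇔ (2) is the definition of alphaAbs. For (1) ⇒ (3) we show more: alpha is preserved by any two
-- injective renamings that agree on the free variables of the left-hand term (alpha-ren). Under a
-- binder the old witness y is traded for a variable z outside the images of the free variables, and
-- the bodies are compared through `rebind`, the renaming conjugated by the swaps [y ∧ x] and [z ∧ f x].
-- Taking identity renamings, any fresh z is a witness, which is (3); this route never needs
-- transitivity of alpha. For (3) ⇒ (1) one fresh variable suffices, and it exists because, by
-- regularity of |var|, a good term has fewer than |var| variable occurrences.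

module Submission where

open import Defs
open import Axiom.ExcludedMiddle using (ExcludedMiddle)
open import Axiom.DoubleNegationElimination using (em⇒dne)
open import Level using (0ℓ)
open import Data.Bool using (Bool; true; false; if_then_else_)
open import Data.Bool.Properties using (¬-not)
open import Data.Empty using (⊥; ⊥-elim)
open import Data.Fin using (zero; suc)
open import Data.Fin.Properties using (2↔Bool)
open import Data.Maybe using (Maybe; just; nothing; Is-just)
open import Data.Maybe.Relation.Unary.All using (All; just; nothing; drop-just)
open import Data.Maybe.Relation.Unary.Any using (just)
import Data.Maybe.Relation.Unary.Any as Any
open import Data.Maybe.Relation.Binary.Pointwise using (Pointwise; just; nothing)
open import Data.Product using (Σ; ∃; ∃-syntax; _×_; _,_; proj₁; proj₂)
open import Data.Sum using (_⊎_; inj₁; inj₂)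
open import Data.Unit using (⊤; tt)
open import Function using (_∘_)
open import Function.Bundles using (_⇔_; _↣_; mk↣; mk⤖; mk↔ₛ′; mk⇔)
open import Function.Construct.Composition using (_↣-∘_; _↔-∘_)
open import Function.Consequences.Propositional using (strictlySurjective⇒surjective)
open import Function.Definitions using (Injective)
open import Function.Properties.Bijection using (⤖⇒↔)
open import Function.Properties.Inverse using (↔-sym)
open import Relation.Binary.Definitions using (DecidableEquality)
open import Relation.Binary.PropositionalEquality using (_≡_; _≢_; refl; sym; trans; cong; subst; module ≡-Reasoning)
open import Relation.Nullary using (¬_; Dec; yes; no)
open import Relation.Nullary.Decidable using (_×-dec_)

module _ {V : Set} where

  ↣-small : {A B : Set} → A ↣ B → B <ᶜ V → A <ᶜ V
  ↣-small A↣B B<V V↣A = B<V (A↣B ↣-∘ V↣A)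

  retract-small : {A B : Set} (h : A → B) (r : B → A) → (∀ a → r (h a) ≡ a) → B <ᶜ V → A <ᶜ V
  retract-small h r r∘h =
    ↣-small (mk↣ {to = h} λ {a} {a'} e → trans (sym (r∘h a)) (trans (cong r e) (r∘h a')))

  dom-∘-small : {α β γ : Set} (inp : α → Maybe β) (h : Maybe β → Maybe γ) →
                (∀ {m} → Is-just (h m) → Is-just m) → dom inp <ᶜ V → dom (h ∘ inp) <ᶜ V
  dom-∘-small inp h is-just = ↣-small (mk↣ {to = λ (i , p) → i , is-just p} injective)
    where
    injective : ∀ {d d' : dom (h ∘ inp)} →
                (proj₁ d , is-just (proj₂ d)) ≡ (proj₁ d' , is-just (proj₂ d')) → d ≡ d'
    injective {i , p} {_ , q} e with cong proj₁ e
    ... | refl = cong (i ,_) (Any.irrelevant (λ _ _ → refl) p q)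

module SmallSets {V : Set} (em : ExcludedMiddle 0ℓ) (infinite : Infinite V) (regular : Regular V) where

  Small : Set → Set
  Small A = A <ᶜ V

  subsingleton-finite : (∀ v w → v ≡ w) → Finite V
  subsingleton-finite unique with em {V}
  ... | yes v = 1 , mk↔ₛ′ (λ _ → zero) (λ _ → v) (λ { zero → refl ; (suc ()) }) (unique v)
  ... | no ¬v = 0 , mk↔ₛ′ (⊥-elim ∘ ¬v) (λ ()) (λ ()) (⊥-elim ∘ ¬v)

  Bool-small : Small Bool
  Bool-small record { to = to ; injective = injective } with em {Σ Bool λ b → ∀ v → to v ≢ b}
  ... | yes (b , missed) =
    infinite (subsingleton-finite λ v w → injective (trans (¬-not (missed v)) (sym (¬-not (missed w)))))
  ... | no ¬missed =
    infinite (2 , ↔-sym 2↔Bool ↔-∘ ⤖⇒↔ (mk⤖ (injective , strictlySurjective⇒surjective hit)))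
    where
    hit : ∀ b → ∃ λ v → to v ≡ b
    hit b = em⇒dne em λ ¬hit → ¬missed (b , λ v e → ¬hit (v , e))

  ⊤-small : Small ⊤
  ⊤-small = ↣-small (mk↣ {to = λ _ → true} λ _ → refl) Bool-small

  ⊥-small : Small ⊥
  ⊥-small = ↣-small (mk↣ {to = λ ()} λ {x} → ⊥-elim x) ⊤-small

  ⊎-small : {A B : Set} → Small A → Small B → Small (A ⊎ B)
  ⊎-small {A} {B} A-small B-small =
    retract-small tag untag untag∘tag (regular Bool Summand Bool-small λ { true → A-small ; false → B-small })
    where
    Summand : Bool → Set
    Summand b = if b then A else B
    tag : A ⊎ B → Σ Bool Summand
    tag (inj₁ a) = true , a
    tag (inj₂ b) = false , b
    untag : Σ Bool Summand → A ⊎ B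
    untag (true , a) = inj₁ a
    untag (false , b) = inj₂ b
    untag∘tag : ∀ u → untag (tag u) ≡ u
    untag∘tag (inj₁ _) = refl
    untag∘tag (inj₂ _) = refl

  Σ-small : {I : Set} {P C : I → Set} → (∀ {i} → C i → P i) →
            Small (Σ I P) → (∀ i → Small (C i)) → Small (Σ I C)
  Σ-small {I} {P} {C} C⇒P P-small C-small =
    retract-small (λ (i , c) → (i , C⇒P c) , c) (λ ((i , _) , c) → i , c) (λ _ → refl)
                  (regular (Σ I P) (C ∘ proj₁) P-small (C-small ∘ proj₁))

  ∃-outside-image : {I : Set} → Small I → (F : I → V) → ∃ λ z → ∀ i → F i ≢ z
  ∃-outside-image {I} I-small F = em⇒dne em λ ¬outside → I-small (V↣I ¬outside)
    where
    V↣I : ¬ (∃ λ z → ∀ i → F i ≢ z) → V ↣ I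
    V↣I ¬outside = mk↣ {to = proj₁ ∘ preimage} λ {v} {w} e →
      trans (sym (proj₂ (preimage v))) (trans (cong F e) (proj₂ (preimage w)))
      where
      preimage : ∀ v → ∃ λ i → F i ≡ v
      preimage v = em⇒dne em λ ¬preimage → ¬outside (v , λ i e → ¬preimage (i , e))

module AlphaAbstraction (var varsort opsym index bindex : Set)
                        (_≟v_ : DecidableEquality var) (_≟s_ : DecidableEquality varsort) where

  open Syntax var varsort opsym index bindex _≟v_ _≟s_

  private variable
    s zs xs : varsort
    v w a b x x' y z : var
    X X' : QTerm

  swapVar-other-sort : s ≢ zs → swapVar zs a b s v ≡ v
  swapVar-other-sort {s} {zs} s≢zs with s ≟s zs
  ... | yes s≡zs = ⊥-elim (s≢zs s≡zs)
  ... | no _ = refl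

  swapVar-left : swapVar zs a b zs a ≡ b
  swapVar-left {zs} {a} with zs ≟s zs
  ... | no zs≢zs = ⊥-elim (zs≢zs refl)
  ... | yes _ with a ≟v a
  ...   | yes _ = refl
  ...   | no a≢a = ⊥-elim (a≢a refl)

  swapVar-right : swapVar zs a b zs b ≡ a
  swapVar-right {zs} {a} {b} with zs ≟s zs
  ... | no zs≢zs = ⊥-elim (zs≢zs refl)
  ... | yes _ with b ≟v a
  ...   | yes b≡a = b≡a
  ...   | no _ with b ≟v b
  ...     | yes _ = refl
  ...     | no b≢b = ⊥-elim (b≢b refl)

  swapVar-id : v ≢ a → v ≢ b → swapVar zs a b s v ≡ v
  swapVar-id {v} {a} {b} {zs} {s} v≢a v≢b with s ≟s zs
  ... | no _ = refl
  ... | yes _ with v ≟v a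
  ...   | yes v≡a = ⊥-elim (v≢a v≡a)
  ...   | no _ with v ≟v b
  ...     | yes v≡b = ⊥-elim (v≢b v≡b)
  ...     | no _ = refl

  swapVar-involutive : swapVar zs a b s (swapVar zs a b s v) ≡ v
  swapVar-involutive {zs} {a} {b} {s} {v} = by-cases (s ≟s zs) (v ≟v a) (v ≟v b)
    where
    by-cases : Dec (s ≡ zs) → Dec (v ≡ a) → Dec (v ≡ b) → swapVar zs a b s (swapVar zs a b s v) ≡ v
    by-cases (no s≢zs) _ _ = trans (cong (swapVar zs a b s) (swapVar-other-sort s≢zs)) (swapVar-other-sort s≢zs)
    by-cases (yes refl) (yes refl) _ = trans (cong (swapVar zs v b zs) swapVar-left) swapVar-right
    by-cases (yes refl) (no _) (yes refl) = trans (cong (swapVar zs a v zs) swapVar-right) swapVar-left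
    by-cases (yes refl) (no v≢a) (no v≢b) =
      trans (cong (swapVar zs a b zs) (swapVar-id v≢a v≢b)) (swapVar-id v≢a v≢b)

  swapVar-injective : Injective _≡_ _≡_ (swapVar zs a b s)
  swapVar-injective {zs} {a} {b} {s} {v} {w} e =
    trans (sym swapVar-involutive) (trans (cong (swapVar zs a b s) e) swapVar-involutive)

  -- Structural equality with inputs compared pointwise: without function extensionality,
  -- _≡_ on quasiterms cannot identify inputs that are merely pointwise equal.
  data _≅_ : QTerm → QTerm → Set
  data _≅ₐ_ : QAbs → QAbs → Set

  data _≅_ where
    qVar : ∀ {s v} → qVar s v ≅ qVar s v
    qOp  : ∀ {δ inp inp' binp binp'} → Lift₂ _≅_ inp inp' → Lift₂ _≅ₐ_ binp binp' →
           qOp δ inp binp ≅ qOp δ inp' binp'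

  data _≅ₐ_ where
    qAbs : ∀ {s v X X'} → X ≅ X' → qAbs s v X ≅ₐ qAbs s v X'

  ≅-sym : ∀ {T U} → T ≅ U → U ≅ T
  ≅-symₐ : ∀ {A B} → A ≅ₐ B → B ≅ₐ A
  ≅-symM : ∀ {m m'} → Pointwise _≅_ m m' → Pointwise _≅_ m' m
  ≅-symMₐ : ∀ {m m'} → Pointwise _≅ₐ_ m m' → Pointwise _≅ₐ_ m' m
  ≅-sym qVar = qVar
  ≅-sym (qOp l lb) = qOp (λ i → ≅-symM (l i)) (λ i → ≅-symMₐ (lb i))
  ≅-symₐ (qAbs e) = qAbs (≅-sym e)
  ≅-symM (just e) = just (≅-sym e)
  ≅-symM nothing = nothing
  ≅-symMₐ (just e) = just (≅-symₐ e)
  ≅-symMₐ nothing = nothing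

  ≅-trans : ∀ {T U W} → T ≅ U → U ≅ W → T ≅ W
  ≅-transₐ : ∀ {A B C} → A ≅ₐ B → B ≅ₐ C → A ≅ₐ C
  ≅-transM : ∀ {m m' m''} → Pointwise _≅_ m m' → Pointwise _≅_ m' m'' → Pointwise _≅_ m m''
  ≅-transMₐ : ∀ {m m' m''} → Pointwise _≅ₐ_ m m' → Pointwise _≅ₐ_ m' m'' → Pointwise _≅ₐ_ m m''
  ≅-trans qVar qVar = qVar
  ≅-trans (qOp l lb) (qOp l' lb') = qOp (λ i → ≅-transM (l i) (l' i)) (λ i → ≅-transMₐ (lb i) (lb' i))
  ≅-transₐ (qAbs e) (qAbs e') = qAbs (≅-trans e e')
  ≅-transM (just e) (just e') = just (≅-trans e e')
  ≅-transM nothing nothing = nothing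
  ≅-transMₐ (just e) (just e') = just (≅-transₐ e e')
  ≅-transMₐ nothing nothing = nothing

  swap-≅ : ∀ {T U} → T ≅ U → (T [ a ∧ b ] zs) ≅ (U [ a ∧ b ] zs)
  swap-≅ₐ : ∀ {A B} → A ≅ₐ B → (A [ a ∧ b ]ₐ zs) ≅ₐ (B [ a ∧ b ]ₐ zs)
  swap-≅M : ∀ {m m'} → Pointwise _≅_ m m' → Pointwise _≅_ (swapM m a b zs) (swapM m' a b zs)
  swap-≅Mₐ : ∀ {m m'} → Pointwise _≅ₐ_ m m' → Pointwise _≅ₐ_ (swapMₐ m a b zs) (swapMₐ m' a b zs)
  swap-≅ qVar = qVar
  swap-≅ (qOp l lb) = qOp (λ i → swap-≅M (l i)) (λ i → swap-≅Mₐ (lb i))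
  swap-≅ₐ (qAbs e) = qAbs (swap-≅ e)
  swap-≅M (just e) = just (swap-≅ e)
  swap-≅M nothing = nothing
  swap-≅Mₐ (just e) = just (swap-≅ₐ e)
  swap-≅Mₐ nothing = nothing

  swap-involutive : ∀ T → ((T [ a ∧ b ] zs) [ a ∧ b ] zs) ≅ T
  swap-involutiveₐ : ∀ A → ((A [ a ∧ b ]ₐ zs) [ a ∧ b ]ₐ zs) ≅ₐ A
  swap-involutiveM : ∀ m → Pointwise _≅_ (swapM (swapM m a b zs) a b zs) m
  swap-involutiveMₐ : ∀ m → Pointwise _≅ₐ_ (swapMₐ (swapMₐ m a b zs) a b zs) m
  swap-involutive {a} {b} {zs} (qVar s v) rewrite swapVar-involutive {zs} {a} {b} {s} {v} = qVar
  swap-involutive (qOp δ inp binp) = qOp (λ i → swap-involutiveM (inp i)) (λ i → swap-involutiveMₐ (binp i))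
  swap-involutiveₐ {a} {b} {zs} (qAbs s v X) rewrite swapVar-involutive {zs} {a} {b} {s} {v} =
    qAbs (swap-involutive X)
  swap-involutiveM nothing = nothing
  swap-involutiveM (just T) = just (swap-involutive T)
  swap-involutiveMₐ nothing = nothing
  swap-involutiveMₐ (just A) = just (swap-involutiveₐ A)

  Ren : Set
  Ren = varsort → var → var

  InjectiveRen : Ren → Set
  InjectiveRen f = ∀ s → Injective _≡_ _≡_ (f s)

  ren : Ren → QTerm → QTerm
  renₐ : Ren → QAbs → QAbs
  renM : Ren → Maybe QTerm → Maybe QTerm
  renMₐ : Ren → Maybe QAbs → Maybe QAbs
  ren f (qVar s v) = qVar s (f s v)
  ren f (qOp δ inp binp) = qOp δ (λ i → renM f (inp i)) (λ i → renMₐ f (binp i))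
  renₐ f (qAbs s v X) = qAbs s (f s v) (ren f X)
  renM f nothing = nothing
  renM f (just T) = just (ren f T)
  renMₐ f nothing = nothing
  renMₐ f (just A) = just (renₐ f A)

  swap≅ren : ∀ T → (T [ a ∧ b ] zs) ≅ ren (swapVar zs a b) T
  swap≅renₐ : ∀ A → (A [ a ∧ b ]ₐ zs) ≅ₐ renₐ (swapVar zs a b) A
  swap≅renM : ∀ m → Pointwise _≅_ (swapM m a b zs) (renM (swapVar zs a b) m)
  swap≅renMₐ : ∀ m → Pointwise _≅ₐ_ (swapMₐ m a b zs) (renMₐ (swapVar zs a b) m)
  swap≅ren (qVar s v) = qVar
  swap≅ren (qOp δ inp binp) = qOp (λ i → swap≅renM (inp i)) (λ i → swap≅renMₐ (binp i))
  swap≅renₐ (qAbs s v X) = qAbs (swap≅ren X)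
  swap≅renM nothing = nothing
  swap≅renM (just T) = just (swap≅ren T)
  swap≅renMₐ nothing = nothing
  swap≅renMₐ (just A) = just (swap≅renₐ A)

  ren-swap : ∀ h T → ren h (T [ a ∧ b ] zs) ≅ ren (λ s v → h s (swapVar zs a b s v)) T
  ren-swapₐ : ∀ h A → renₐ h (A [ a ∧ b ]ₐ zs) ≅ₐ renₐ (λ s v → h s (swapVar zs a b s v)) A
  ren-swapM : ∀ h m → Pointwise _≅_ (renM h (swapM m a b zs)) (renM (λ s v → h s (swapVar zs a b s v)) m)
  ren-swapMₐ : ∀ h m →
               Pointwise _≅ₐ_ (renMₐ h (swapMₐ m a b zs)) (renMₐ (λ s v → h s (swapVar zs a b s v)) m)
  ren-swap h (qVar s v) = qVar
  ren-swap h (qOp δ inp binp) = qOp (λ i → ren-swapM h (inp i)) (λ i → ren-swapMₐ h (binp i))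
  ren-swapₐ h (qAbs s v X) = qAbs (ren-swap h X)
  ren-swapM h nothing = nothing
  ren-swapM h (just T) = just (ren-swap h T)
  ren-swapMₐ h nothing = nothing
  ren-swapMₐ h (just A) = just (ren-swapₐ h A)

  swap-ren : ∀ f T → (ren f T [ a ∧ b ] zs) ≅ ren (λ s v → swapVar zs a b s (f s v)) T
  swap-renₐ : ∀ f A → (renₐ f A [ a ∧ b ]ₐ zs) ≅ₐ renₐ (λ s v → swapVar zs a b s (f s v)) A
  swap-renM : ∀ f m → Pointwise _≅_ (swapM (renM f m) a b zs) (renM (λ s v → swapVar zs a b s (f s v)) m)
  swap-renMₐ : ∀ f m →
               Pointwise _≅ₐ_ (swapMₐ (renMₐ f m) a b zs) (renMₐ (λ s v → swapVar zs a b s (f s v)) m)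
  swap-ren f (qVar s v) = qVar
  swap-ren f (qOp δ inp binp) = qOp (λ i → swap-renM f (inp i)) (λ i → swap-renMₐ f (binp i))
  swap-renₐ f (qAbs s v X) = qAbs (swap-ren f X)
  swap-renM f nothing = nothing
  swap-renM f (just T) = just (swap-ren f T)
  swap-renMₐ f nothing = nothing
  swap-renMₐ f (just A) = just (swap-renₐ f A)

  swap-ren-id : ∀ T → (ren (λ _ v → v) T [ a ∧ b ] zs) ≅ (T [ a ∧ b ] zs)
  swap-ren-id T = ≅-trans (swap-ren _ T) (≅-sym (swap≅ren T))

  ren-ext : ∀ {f g} → (∀ s v → f s v ≡ g s v) → ∀ T → ren f T ≅ ren g T
  ren-extₐ : ∀ {f g} → (∀ s v → f s v ≡ g s v) → ∀ A → renₐ f A ≅ₐ renₐ g A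
  ren-extM : ∀ {f g} → (∀ s v → f s v ≡ g s v) → ∀ m → Pointwise _≅_ (renM f m) (renM g m)
  ren-extMₐ : ∀ {f g} → (∀ s v → f s v ≡ g s v) → ∀ m → Pointwise _≅ₐ_ (renMₐ f m) (renMₐ g m)
  ren-ext f≗g (qVar s v) rewrite f≗g s v = qVar
  ren-ext f≗g (qOp δ inp binp) = qOp (λ i → ren-extM f≗g (inp i)) (λ i → ren-extMₐ f≗g (binp i))
  ren-extₐ f≗g (qAbs s v X) rewrite f≗g s v = qAbs (ren-ext f≗g X)
  ren-extM f≗g nothing = nothing
  ren-extM f≗g (just T) = just (ren-ext f≗g T)
  ren-extMₐ f≗g nothing = nothing
  ren-extMₐ f≗g (just A) = just (ren-extₐ f≗g A)

  freshAbs-body : freshAbs s v (qAbs xs x X) → ¬ (s ≡ xs × v ≡ x) → fresh s v X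
  freshAbs-body (qAbs (inj₁ bound)) not-bound = ⊥-elim (not-bound bound)
  freshAbs-body (qAbs (inj₂ fr)) _ = fr

  fresh-inp : ∀ {δ inp binp} → fresh s v (qOp δ inp binp) → Lift (fresh s v) inp
  fresh-inp (qOp fr _) = fr

  fresh-binp : ∀ {δ inp binp} → fresh s v (qOp δ inp binp) → Lift (freshAbs s v) binp
  fresh-binp (qOp _ fr) = fr

  fresh-≅ : ∀ {T U} → T ≅ U → fresh s v T → fresh s v U
  fresh-≅ₐ : ∀ {A B} → A ≅ₐ B → freshAbs s v A → freshAbs s v B
  fresh-≅M : ∀ {m m'} → Pointwise _≅_ m m' → All (fresh s v) m → All (fresh s v) m'
  fresh-≅Mₐ : ∀ {m m'} → Pointwise _≅ₐ_ m m' → All (freshAbs s v) m → All (freshAbs s v) m'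
  fresh-≅ qVar fr = fr
  fresh-≅ (qOp l lb) (qOp fr frb) = qOp (λ i → fresh-≅M (l i) (fr i)) (λ i → fresh-≅Mₐ (lb i) (frb i))
  fresh-≅ₐ (qAbs e) (qAbs (inj₁ bound)) = qAbs (inj₁ bound)
  fresh-≅ₐ (qAbs e) (qAbs (inj₂ fr)) = qAbs (inj₂ (fresh-≅ e fr))
  fresh-≅M (just e) (just fr) = just (fresh-≅ e fr)
  fresh-≅M nothing nothing = nothing
  fresh-≅Mₐ (just e) (just fr) = just (fresh-≅ₐ e fr)
  fresh-≅Mₐ nothing nothing = nothing

  fresh-ren : ∀ f T → (∀ w → f s w ≡ z → fresh s w T) → fresh s z (ren f T)
  fresh-renₐ : ∀ f A → (∀ w → f s w ≡ z → freshAbs s w A) → freshAbs s z (renₐ f A)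
  fresh-renM : ∀ f m → (∀ w → f s w ≡ z → All (fresh s w) m) → All (fresh s z) (renM f m)
  fresh-renMₐ : ∀ f m → (∀ w → f s w ≡ z → All (freshAbs s w) m) → All (freshAbs s z) (renMₐ f m)
  fresh-ren f (qVar s v) avoids = qVar λ { (refl , fv≡z) → not-fresh (avoids v (sym fv≡z)) }
    where
    not-fresh : ¬ fresh s v (qVar s v)
    not-fresh (qVar not-equal) = not-equal (refl , refl)
  fresh-ren f (qOp δ inp binp) avoids =
    qOp (λ i → fresh-renM f (inp i) λ w e → fresh-inp (avoids w e) i)
        (λ i → fresh-renMₐ f (binp i) λ w e → fresh-binp (avoids w e) i)
  fresh-renₐ {s} {z} f (qAbs xs x X) avoids with s ≟s xs | z ≟v f xs x
  ... | yes refl | yes refl = qAbs (inj₁ (refl , refl))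
  ... | yes refl | no z≢fx =
    qAbs (inj₂ (fresh-ren f X λ w e → freshAbs-body (avoids w e) λ { (_ , refl) → z≢fx (sym e) }))
  ... | no s≢xs | _ = qAbs (inj₂ (fresh-ren f X λ w e → freshAbs-body (avoids w e) λ (e' , _) → s≢xs e'))
  fresh-renM f nothing avoids = nothing
  fresh-renM f (just T) avoids = just (fresh-ren f T λ w e → drop-just (avoids w e))
  fresh-renMₐ f nothing avoids = nothing
  fresh-renMₐ f (just A) avoids = just (fresh-renₐ f A λ w e → drop-just (avoids w e))

  fresh-swap : ∀ T → fresh s v T → fresh s (swapVar zs a b s v) (T [ a ∧ b ] zs)
  fresh-swap T fr =
    fresh-≅ (≅-sym (swap≅ren T))
            (fresh-ren _ T λ w e → subst (λ u → fresh _ u T) (sym (swapVar-injective e)) fr)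

  fresh-swap⁻¹ : ∀ T → fresh s (swapVar zs a b s v) (T [ a ∧ b ] zs) → fresh s v T
  fresh-swap⁻¹ T fr =
    fresh-≅ (swap-involutive T) (subst (λ u → fresh _ u _) swapVar-involutive (fresh-swap (T [ _ ∧ _ ] _) fr))

  fresh-swap-fixed : ∀ T → swapVar zs a b s v ≡ v → fresh s v T → fresh s v (T [ a ∧ b ] zs)
  fresh-swap-fixed T fixed fr = subst (λ u → fresh _ u _) fixed (fresh-swap T fr)

  fresh-swap-fixed⁻¹ : ∀ T → swapVar zs a b s v ≡ v → fresh s v (T [ a ∧ b ] zs) → fresh s v T
  fresh-swap-fixed⁻¹ T fixed fr = fresh-swap⁻¹ T (subst (λ u → fresh _ u _) (sym fixed) fr)

  fresh-swap-left : ∀ T → fresh zs a T → fresh zs b (T [ a ∧ b ] zs)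
  fresh-swap-left {zs} {a} {b} T fr = subst (λ u → fresh zs u (T [ a ∧ b ] zs)) swapVar-left (fresh-swap T fr)

  freshAbs⇒fresh-swapped : freshAbs s v (qAbs xs x X) → fresh xs y X → ¬ (s ≡ xs × v ≡ y) →
                           fresh s v (X [ y ∧ x ] xs)
  freshAbs⇒fresh-swapped {s} {v} {xs} {x} {X} fr yX v≠y with s ≟s xs
  ... | no s≢xs = fresh-swap-fixed X (swapVar-other-sort s≢xs) (freshAbs-body fr λ (e , _) → s≢xs e)
  ... | yes refl with v ≟v x
  ...   | yes refl = fresh-swap-left X yX
  ...   | no v≢x =
    fresh-swap-fixed X (swapVar-id (λ e → v≠y (refl , e)) v≢x) (freshAbs-body fr λ (_ , e) → v≢x e)

  fresh-swapped⇒freshAbs : fresh s v (X [ y ∧ x ] xs) → ¬ (s ≡ xs × v ≡ y) → freshAbs s v (qAbs xs x X)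
  fresh-swapped⇒freshAbs {s} {v} {X} {x = x} {xs} fr v≠y with s ≟s xs
  ... | no s≢xs = qAbs (inj₂ (fresh-swap-fixed⁻¹ X (swapVar-other-sort s≢xs) fr))
  ... | yes refl with v ≟v x
  ...   | yes refl = qAbs (inj₁ (refl , refl))
  ...   | no v≢x = qAbs (inj₂ (fresh-swap-fixed⁻¹ X (swapVar-id (λ e → v≠y (refl , e)) v≢x) fr))

  α-sym : ∀ {T U} → alpha T U → alpha U T
  α-symₐ : ∀ {A B} → alphaAbs A B → alphaAbs B A
  α-symM : ∀ {m m'} → Pointwise alpha m m' → Pointwise alpha m' m
  α-symMₐ : ∀ {m m'} → Pointwise alphaAbs m m' → Pointwise alphaAbs m' m
  α-sym qVar = qVar
  α-sym (qOp l lb) = qOp (λ i → α-symM (l i)) (λ i → α-symMₐ (lb i))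
  α-symₐ (qAbs y y≢x y≢x' yX yX' body) = qAbs y y≢x' y≢x yX' yX (α-sym body)
  α-symM (just r) = just (α-sym r)
  α-symM nothing = nothing
  α-symMₐ (just r) = just (α-symₐ r)
  α-symMₐ nothing = nothing

  fresh-α : ∀ {T U} → alpha T U → fresh s v T → fresh s v U
  fresh-αₐ : ∀ {A B} → alphaAbs A B → freshAbs s v A → freshAbs s v B
  fresh-αM : ∀ {m m'} → Pointwise alpha m m' → All (fresh s v) m → All (fresh s v) m'
  fresh-αMₐ : ∀ {m m'} → Pointwise alphaAbs m m' → All (freshAbs s v) m → All (freshAbs s v) m'
  fresh-α qVar fr = fr
  fresh-α (qOp l lb) (qOp fr frb) = qOp (λ i → fresh-αM (l i) (fr i)) (λ i → fresh-αMₐ (lb i) (frb i))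
  fresh-αₐ {s} {v} (qAbs {xs} y _ _ yX yX' body) fr with (s ≟s xs) ×-dec (v ≟v y)
  ... | yes (refl , refl) = qAbs (inj₂ yX')
  ... | no v≠y = fresh-swapped⇒freshAbs (fresh-α body (freshAbs⇒fresh-swapped fr yX v≠y)) v≠y
  fresh-αM (just r) (just fr) = just (fresh-α r fr)
  fresh-αM nothing nothing = nothing
  fresh-αMₐ (just r) (just fr) = just (fresh-αₐ r fr)
  fresh-αMₐ nothing nothing = nothing

  α-≅ : ∀ {T' T U U'} → T' ≅ T → alpha T U → U ≅ U' → alpha T' U'
  α-≅ₐ : ∀ {A' A B B'} → A' ≅ₐ A → alphaAbs A B → B ≅ₐ B' → alphaAbs A' B'
  α-≅M : ∀ {m₁ m₂ m₃ m₄} → Pointwise _≅_ m₁ m₂ → Pointwise alpha m₂ m₃ → Pointwise _≅_ m₃ m₄ →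
         Pointwise alpha m₁ m₄
  α-≅Mₐ : ∀ {m₁ m₂ m₃ m₄} → Pointwise _≅ₐ_ m₁ m₂ → Pointwise alphaAbs m₂ m₃ → Pointwise _≅ₐ_ m₃ m₄ →
          Pointwise alphaAbs m₁ m₄
  α-≅ qVar qVar qVar = qVar
  α-≅ (qOp l lb) (qOp r rb) (qOp l' lb') =
    qOp (λ i → α-≅M (l i) (r i) (l' i)) (λ i → α-≅Mₐ (lb i) (rb i) (lb' i))
  α-≅ₐ (qAbs e) (qAbs y y≢x y≢x' yX yX' body) (qAbs e') =
    qAbs y y≢x y≢x' (fresh-≅ (≅-sym e) yX) (fresh-≅ e' yX') (α-≅ (swap-≅ e) body (swap-≅ e'))
  α-≅M (just e) (just r) (just e') = just (α-≅ e r e')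
  α-≅M nothing nothing nothing = nothing
  α-≅Mₐ (just e) (just r) (just e') = just (α-≅ₐ e r e')
  α-≅Mₐ nothing nothing nothing = nothing

  good-swap : ∀ T → good T → good (T [ a ∧ b ] zs)
  good-swapₐ : ∀ A → goodAbs A → goodAbs (A [ a ∧ b ]ₐ zs)
  good-swapM : ∀ m → All qGood m → All qGood (swapM m a b zs)
  good-swapMₐ : ∀ m → All qGoodAbs m → All qGoodAbs (swapMₐ m a b zs)
  good-swap (qVar s v) qVar = qVar
  good-swap (qOp δ inp binp) (qOp g gb small smallb) =
    qOp (λ i → good-swapM (inp i) (g i)) (λ i → good-swapMₐ (binp i) (gb i))
        (dom-∘-small inp _ is-just-swapM small) (dom-∘-small binp _ is-just-swapMₐ smallb)
    where
    is-just-swapM : ∀ {m} → Is-just (swapM m a b zs) → Is-just m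
    is-just-swapM {m = just _} _ = just tt
    is-just-swapMₐ : ∀ {m} → Is-just (swapMₐ m a b zs) → Is-just m
    is-just-swapMₐ {m = just _} _ = just tt
  good-swapₐ (qAbs s v X) (qAbs g) = qAbs (good-swap X g)
  good-swapM nothing nothing = nothing
  good-swapM (just T) (just g) = just (good-swap T g)
  good-swapMₐ nothing nothing = nothing
  good-swapMₐ (just A) (just g) = just (good-swapₐ A g)

  rebind : Ren → varsort → var → var → var → Ren
  rebind f xs y x z s v = swapVar xs z (f xs x) s (f s (swapVar xs y x s v))

  ren-rebind : ∀ f X → ren (rebind f xs y x z) (X [ y ∧ x ] xs) ≅ (ren f X [ z ∧ f xs x ] xs)
  ren-rebind {xs} {y} {x} {z} f X =
    ≅-trans (ren-swap _ X)
      (≅-trans (ren-ext (λ s v → cong (λ u → swapVar xs z (f xs x) s (f s u)) swapVar-involutive) X)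
               (≅-sym (swap-ren f X)))

  rebind-injective : ∀ {f} → InjectiveRen f → InjectiveRen (rebind f xs y x z)
  rebind-injective f-inj s e = swapVar-injective (f-inj s (swapVar-injective e))

  rebind-witness : ∀ f → rebind f xs y x z xs y ≡ z
  rebind-witness {xs} {y} {x} {z} f =
    trans (cong (λ u → swapVar xs z (f xs x) xs (f xs u)) swapVar-left) swapVar-right

  rebind-elsewhere : ∀ {f} → InjectiveRen f → ¬ (s ≡ xs × v ≡ y) → ¬ (s ≡ xs × v ≡ x) →
                     ¬ (s ≡ xs × f s v ≡ z) → rebind f xs y x z s v ≡ f s v
  rebind-elsewhere {s} {xs} {v} {y} {x} {z} {f} f-inj v≠y v≠x fv≠z = by-sort (s ≟s xs)
    where
    by-sort : Dec (s ≡ xs) → rebind f xs y x z s v ≡ f s v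
    by-sort (no s≢xs) =
      trans (cong (swapVar xs z (f xs x) s ∘ f s) (swapVar-other-sort s≢xs)) (swapVar-other-sort s≢xs)
    by-sort (yes refl) =
      trans (cong (swapVar xs z (f xs x) xs ∘ f xs)
                  (swapVar-id (λ e → v≠y (refl , e)) (λ e → v≠x (refl , e))))
            (swapVar-id (λ e → fv≠z (refl , e)) (λ e → v≠x (refl , f-inj xs e)))

  module FreshVariables (em : ExcludedMiddle 0ℓ) (infinite : Infinite var) (regular : Regular var) where

    open SmallSets em infinite regular

    Occ : QTerm → Set
    Occₐ : QAbs → Set
    OccM : Maybe QTerm → Set
    OccMₐ : Maybe QAbs → Set
    Occ (qVar s v) = ⊤
    Occ (qOp δ inp binp) = Σ index (OccM ∘ inp) ⊎ Σ bindex (OccMₐ ∘ binp)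
    Occₐ (qAbs s v X) = Occ X
    OccM nothing = ⊥
    OccM (just T) = Occ T
    OccMₐ nothing = ⊥
    OccMₐ (just A) = Occₐ A

    occ : ∀ T → Occ T → var
    occₐ : ∀ A → Occₐ A → var
    occM : ∀ m → OccM m → var
    occMₐ : ∀ m → OccMₐ m → var
    occ (qVar s v) _ = v
    occ (qOp δ inp binp) (inj₁ (i , p)) = occM (inp i) p
    occ (qOp δ inp binp) (inj₂ (i , p)) = occMₐ (binp i) p
    occₐ (qAbs s v X) p = occ X p
    occM (just T) p = occ T p
    occMₐ (just A) p = occₐ A p

    unoccurring⇒fresh : ∀ T → (∀ p → occ T p ≢ w) → fresh s w T
    unoccurring⇒freshₐ : ∀ A → (∀ p → occₐ A p ≢ w) → freshAbs s w A
    unoccurring⇒freshM : ∀ m → (∀ p → occM m p ≢ w) → All (fresh s w) m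
    unoccurring⇒freshMₐ : ∀ m → (∀ p → occMₐ m p ≢ w) → All (freshAbs s w) m
    unoccurring⇒fresh (qVar s v) unocc = qVar λ (_ , w≡v) → unocc tt (sym w≡v)
    unoccurring⇒fresh (qOp δ inp binp) unocc =
      qOp (λ i → unoccurring⇒freshM (inp i) λ p → unocc (inj₁ (i , p)))
          (λ i → unoccurring⇒freshMₐ (binp i) λ p → unocc (inj₂ (i , p)))
    unoccurring⇒freshₐ (qAbs s v X) unocc = qAbs (inj₂ (unoccurring⇒fresh X unocc))
    unoccurring⇒freshM nothing unocc = nothing
    unoccurring⇒freshM (just T) unocc = just (unoccurring⇒fresh T unocc)
    unoccurring⇒freshMₐ nothing unocc = nothing
    unoccurring⇒freshMₐ (just A) unocc = just (unoccurring⇒freshₐ A unocc)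

    Occ-small : ∀ {T} → good T → Small (Occ T)
    Occₐ-small : ∀ {A} → goodAbs A → Small (Occₐ A)
    OccM-small : ∀ {m} → All qGood m → Small (OccM m)
    OccMₐ-small : ∀ {m} → All qGoodAbs m → Small (OccMₐ m)
    Occ-small qVar = ⊤-small
    Occ-small {qOp δ inp binp} (qOp g gb small smallb) =
      ⊎-small (Σ-small (OccM⇒is-just (inp _)) small (λ i → OccM-small (g i)))
              (Σ-small (OccMₐ⇒is-just (binp _)) smallb (λ i → OccMₐ-small (gb i)))
      where
      OccM⇒is-just : ∀ m → OccM m → Is-just m
      OccM⇒is-just (just _) _ = just tt
      OccMₐ⇒is-just : ∀ m → OccMₐ m → Is-just m
      OccMₐ⇒is-just (just _) _ = just tt
    Occₐ-small (qAbs g) = Occ-small g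
    OccM-small nothing = ⊥-small
    OccM-small (just g) = Occ-small g
    OccMₐ-small nothing = ⊥-small
    OccMₐ-small (just g) = Occₐ-small g

    ∃-fresh : good X → good X' → (f g : Ren) (s : varsort) (e e' : var) →
              ∃ λ z → (∀ w → f s w ≡ z → fresh s w X) × (∀ w → g s w ≡ z → fresh s w X') × z ≢ e × z ≢ e'
    ∃-fresh {X} {X'} gX gX' f g s e e' =
      avoiding (∃-outside-image (⊎-small (⊎-small (Occ-small gX) (Occ-small gX')) Bool-small) forbidden)
      where
      forbidden : (Occ X ⊎ Occ X') ⊎ Bool → var
      forbidden (inj₁ (inj₁ p)) = f s (occ X p)
      forbidden (inj₁ (inj₂ p)) = g s (occ X' p)
      forbidden (inj₂ true) = e
      forbidden (inj₂ false) = e'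
      avoiding : (∃ λ z → ∀ i → forbidden i ≢ z) →
                 ∃ λ z → (∀ w → f s w ≡ z → fresh s w X) × (∀ w → g s w ≡ z → fresh s w X') × z ≢ e × z ≢ e'
      avoiding (z , outside) =
        z , (λ w fw≡z → unoccurring⇒fresh X λ p occ≡w →
                          outside (inj₁ (inj₁ p)) (trans (cong (f s) occ≡w) fw≡z))
          , (λ w gw≡z → unoccurring⇒fresh X' λ p occ≡w →
                          outside (inj₁ (inj₂ p)) (trans (cong (g s) occ≡w) gw≡z))
          , (λ z≡e → outside (inj₂ true) (sym z≡e))
          , (λ z≡e' → outside (inj₂ false) (sym z≡e'))

    alpha-ren : ∀ {T U} → alpha T U → good T → good U → ∀ {f g} → InjectiveRen f → InjectiveRen g →
                (∀ s v → ¬ fresh s v T → f s v ≡ g s v) → alpha (ren f T) (ren g U)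
    alpha-renₐ : ∀ {A B} → alphaAbs A B → goodAbs A → goodAbs B → ∀ {f g} → InjectiveRen f → InjectiveRen g →
                 (∀ s v → ¬ freshAbs s v A → f s v ≡ g s v) → alphaAbs (renₐ f A) (renₐ g B)
    alpha-renM : ∀ {m m'} → Pointwise alpha m m' → All qGood m → All qGood m' → ∀ {f g} →
                 InjectiveRen f → InjectiveRen g →
                 (∀ s v → ¬ All (fresh s v) m → f s v ≡ g s v) → Pointwise alpha (renM f m) (renM g m')
    alpha-renMₐ : ∀ {m m'} → Pointwise alphaAbs m m' → All qGoodAbs m → All qGoodAbs m' → ∀ {f g} →
                  InjectiveRen f → InjectiveRen g →
                  (∀ s v → ¬ All (freshAbs s v) m → f s v ≡ g s v) → Pointwise alphaAbs (renMₐ f m) (renMₐ g m')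
    alpha-ren-body : ∀ {f g} → alpha (X [ y ∧ x ] xs) (X' [ y ∧ x' ] xs) → fresh xs y X → fresh xs y X' →
                     good X → good X' → InjectiveRen f → InjectiveRen g →
                     (∀ s v → ¬ freshAbs s v (qAbs xs x X) → f s v ≡ g s v) →
                     (∀ w → f xs w ≡ z → fresh xs w X) → (∀ w → g xs w ≡ z → fresh xs w X') →
                     alpha (ren f X [ z ∧ f xs x ] xs) (ren g X' [ z ∧ g xs x' ] xs)

    alpha-ren {qVar s v} qVar _ _ {f} {g} _ _ agree
      rewrite agree s v λ { (qVar not-equal) → not-equal (refl , refl) } = qVar
    alpha-ren (qOp r rb) (qOp g gb _ _) (qOp g' gb' _ _) f-inj g-inj agree =
      qOp (λ i → alpha-renM (r i) (g i) (g' i) f-inj g-inj λ s v not-fresh →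
                   agree s v λ fr → not-fresh (fresh-inp fr i))
          (λ i → alpha-renMₐ (rb i) (gb i) (gb' i) f-inj g-inj λ s v not-fresh →
                   agree s v λ fr → not-fresh (fresh-binp fr i))
    alpha-renM (just r) (just g) (just g') f-inj g-inj agree =
      just (alpha-ren r g g' f-inj g-inj λ s v not-fresh → agree s v (not-fresh ∘ drop-just))
    alpha-renM nothing _ _ _ _ _ = nothing
    alpha-renMₐ (just r) (just g) (just g') f-inj g-inj agree =
      just (alpha-renₐ r g g' f-inj g-inj λ s v not-fresh → agree s v (not-fresh ∘ drop-just))
    alpha-renMₐ nothing _ _ _ _ _ = nothing
    alpha-renₐ {qAbs xs x X} {qAbs _ x' X'} (qAbs y _ _ yX yX' body) (qAbs gX) (qAbs gX') {f} {g} f-inj g-inj agree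
      with ∃-fresh gX gX' f g xs (f xs x) (g xs x')
    ... | z , zX , zX' , z≢fx , z≢gx' =
      qAbs z z≢fx z≢gx' (fresh-ren f X zX) (fresh-ren g X' zX')
           (alpha-ren-body body yX yX' gX gX' f-inj g-inj agree zX zX')

    alpha-ren-body {X} {y} {x} {xs} {X'} {x'} {z} {f} {g} body yX yX' gX gX' f-inj g-inj agree zX zX' =
      α-≅ (≅-sym (ren-rebind f X))
          (alpha-ren body (good-swap X gX) (good-swap X' gX')
                     (rebind-injective f-inj) (rebind-injective g-inj) rebinds-agree)
          (ren-rebind g X')
      where
      rebinds-agree : ∀ s v → ¬ fresh s v (X [ y ∧ x ] xs) → rebind f xs y x z s v ≡ rebind g xs y x' z s v
      rebinds-agree s v v-free with (s ≟s xs) ×-dec (v ≟v y)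
      ... | yes (refl , refl) = trans (rebind-witness f) (sym (rebind-witness g))
      ... | no v≠y = begin
        rebind f xs y x z s v   ≡⟨ rebind-elsewhere f-inj v≠y (λ bound → free (qAbs (inj₁ bound)))
                                     (λ { (refl , fv≡z) → free (qAbs (inj₂ (zX v fv≡z))) }) ⟩
        f s v                   ≡⟨ agree s v free ⟩
        g s v                   ≡⟨ rebind-elsewhere g-inj v≠y (λ bound → free' (qAbs (inj₁ bound)))
                                     (λ { (refl , gv≡z) → free' (qAbs (inj₂ (zX' v gv≡z))) }) ⟨
        rebind g xs y x' z s v  ∎
        where
        open ≡-Reasoning
        free : ¬ freshAbs s v (qAbs xs x X)
        free fr = v-free (freshAbs⇒fresh-swapped fr yX v≠y)
        free' : ¬ freshAbs s v (qAbs xs x' X')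
        free' fr = v-free (fresh-α (α-sym body) (freshAbs⇒fresh-swapped fr yX' v≠y))

    ≈ₐ⇒every-witness : alphaAbs (qAbs xs x X) (qAbs xs x' X') → good X → good X' →
                       ∀ y → fresh xs y X → fresh xs y X' → alpha (X [ y ∧ x ] xs) (X' [ y ∧ x' ] xs)
    ≈ₐ⇒every-witness {X = X} {X' = X'} (qAbs _ _ _ y₀X y₀X' body) gX gX' y yX yX' =
      α-≅ (≅-sym (swap-ren-id X))
          (alpha-ren-body body y₀X y₀X' gX gX' (λ _ e → e) (λ _ e → e) (λ _ _ _ → refl)
                          (λ { _ refl → yX }) (λ { _ refl → yX' }))
          (swap-ren-id X')

    every-witness⇒≈ₐ : good X → good X' →
                       (∀ y → y ≢ x → y ≢ x' → fresh xs y X → fresh xs y X' →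
                        alpha (X [ y ∧ x ] xs) (X' [ y ∧ x' ] xs)) →
                       alphaAbs (qAbs xs x X) (qAbs xs x' X')
    every-witness⇒≈ₐ {x = x} {x' = x'} {xs = xs} gX gX' every
      with ∃-fresh gX gX' (λ _ v → v) (λ _ v → v) xs x x'
    ... | y , yX , yX' , y≢x , y≢x' =
      qAbs y y≢x y≢x' (yX y refl) (yX' y refl) (every y y≢x y≢x' (yX y refl) (yX' y refl))

proposition3 : (var varsort opsym index bindex : Set)
    (_≟v_ : DecidableEquality var) (_≟s_ : DecidableEquality varsort) →
    ExcludedMiddle 0ℓ → Infinite var → Regular var →
    let open Syntax var varsort opsym index bindex _≟v_ _≟s_ in
    ∀ {X X' : term} {xs xs' : varsort} {x x' : var} → good X → good X' →
    ((Abs xs x X ≈ₐ Abs xs' x' X') ⇔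
      (xs ≡ xs' × ∃[ y ] (y ≢ x × y ≢ x' × fresh xs y X × fresh xs y X' ×
                          ((X [ y ∧ x ] xs) ≈ (X' [ y ∧ x' ] xs)))))
    × ((Abs xs x X ≈ₐ Abs xs' x' X') ⇔
      (xs ≡ xs' × (∀ y → y ≢ x → y ≢ x' → fresh xs y X → fresh xs y X' →
                   (X [ y ∧ x ] xs) ≈ (X' [ y ∧ x' ] xs))))
proposition3 var varsort opsym index bindex _≟v_ _≟s_ em infinite regular gX gX' =
  mk⇔ (λ { (qAbs y y≢x y≢x' yX yX' body) → refl , y , y≢x , y≢x' , yX , yX' , body })
      (λ { (refl , y , y≢x , y≢x' , yX , yX' , body) → qAbs y y≢x y≢x' yX yX' body }) ,
  mk⇔ (λ { r@(qAbs _ _ _ _ _ _) → refl , λ y _ _ → ≈ₐ⇒every-witness r gX gX' y })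
      (λ { (refl , every) → every-witness⇒≈ₐ gX gX' every })
  where
  open Syntax var varsort opsym index bindex _≟v_ _≟s_
  open AlphaAbstraction var varsort opsym index bindex _≟v_ _≟s_
  open FreshVariables em infinite regular
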